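{- Let $A,B\in I(k,l)$ be $(t_i,u_j)$-adjacent, let $v\in a_{k,l}(n)$, and let $P_A$, $P_B$ be the insertion tableaux of $v$ under the $A$-RSK and the $B$-RSK respectively. Then the cells of $P_A$ whose entries are less than both $t_i$ and $u_j$ (in $A$, equivalently in $B$), together with these entries, coincide with the cells of $P_B$ whose entries are less than both $t_i$ and $u_j$, together with their entries; i.e. these elements form identical subtableaux of $P_A$ and $P_B$.
   Context: Let $t_1,\dots,t_k,u_1,\dots,u_l$ be distinct symbols ("$t$-letters" and "$u$-letters"). A shuffle is a total order $<_A$ with $t_1<_A\cdots<_A t_k$ and $u_1<_A\cdots<_A u_l$; $I(k,l)$ is the set of shuffles. Two shuffles $A,B$ are $(t_i,u_j)$-adjacent if $t_i<_A u_j$, $u_j<_B t_i$, and all other pairs of letters are ordered the same way in $A$ and in $B$. $a_{k,l}(n)$ is the set of words of length $n$ in these letters. $c(i,j)$ is the cell in row $i$, column $j$ (English convention). $A$-RSK insertion of a letter $x$ proceeds in steps: initially $x$ is inserted into row 1 if a $t$-letter, into column 1 if a $u$-letter. Inserting a $t$-letter $y$ into row $r$: $y$ bumps the leftmost entry of row $r$ strictly $A$-greater than $y$, or if none, is placed in a new cell at the end of row $r$. Inserting a $u$-letter $y$ into column $c$: $y$ bumps the topmost entry of column $c$ strictly $A$-greater than $y$, or if none, is placed in a new cell at the bottom of column $c$. An entry bumped from $c(i,j)$ is next inserted into row $i+1$ if a $t$-letter, into column $j+1$ if a $u$-letter; insertion ends when a new cell is created. The insertion tableau of $v$ is obtained by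 inserting $v_1,\dots,v_n$ successively into the empty tableau. -}

module Defs where

open import Data.Nat using (ℕ; zero; suc; _<_; _≟_)
open import Data.Fin as Fin using (Fin)
open import Data.Sum using (_⊎_; inj₁; inj₂)
open import Data.Product using (_×_)
open import Data.Maybe using (Maybe; just; nothing)
open import Data.Bool using (if_then_else_; _∧_)
open import Data.Vec using (Vec; []; _∷_)
open import Relation.Nullary using (¬_; does)
open import Relation.Binary.PropositionalEquality using (_≡_; _≢_)
open import Function.Bundles using (_⇔_)

-- Letters: t-letters t₁..t_k are  inj₁ i  (i : Fin k), u-letters u₁..u_l are  inj₂ j.
Letter : ℕ → ℕ → Set
Letter k l = Fin k ⊎ Fin l

tL : ∀ {k l} → Fin k → Letter k l
tL = inj₁

uL : ∀ {k l} → Fin l → Letter k l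
uL = inj₂

-- A shuffle: a strict total order on the letters, given by an injective rank
-- function (x <_A y  iff  rank x < rank y), with t₁ < ... < t_k and u₁ < ... < u_l.
record Shuffle (k l : ℕ) : Set where
  field
    rank     : Letter k l → ℕ
    rank-inj : ∀ x y → rank x ≡ rank y → x ≡ y
    t-mono   : ∀ (a a' : Fin k) → a Fin.< a' → rank (tL a) < rank (tL a')
    u-mono   : ∀ (b b' : Fin l) → b Fin.< b' → rank (uL b) < rank (uL b')
open Shuffle public

_<[_]_ : ∀ {k l} → Letter k l → Shuffle k l → Letter k l → Set
x <[ A ] y = rank A x < rank A y

Adjacent : ∀ {k l} → Shuffle k l → Shuffle k l → Fin k → Fin l → Set
Adjacent {k} {l} A B i j =
  (tL i <[ A ] uL j) × (uL j <[ B ] tL i) ×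
  (∀ (x y : Letter k l) → ¬ (x ≡ tL i × y ≡ uL j) → ¬ (x ≡ uL j × y ≡ tL i) →
     ((x <[ A ] y) ⇔ (x <[ B ] y)))

-- A (partial) tableau: cell c(r,c) (0-based row r, column c) ↦ its entry, if any.
Tableau : ℕ → ℕ → Set
Tableau k l = ℕ → ℕ → Maybe (Letter k l)

emptyT : ∀ {k l} → Tableau k l
emptyT _ _ = nothing

setCell : ∀ {k l} → Tableau k l → ℕ → ℕ → Letter k l → Tableau k l
setCell T r c x i j = if does (i ≟ r) ∧ does (j ≟ c) then just x else T i j

LeftmostGreaterInRow : ∀ {k l} → Shuffle k l → Tableau k l → ℕ → Letter k l → ℕ → Letter k l → Set
LeftmostGreaterInRow A T r y c z =
  (T r c ≡ just z) × (y <[ A ] z) ×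
  (∀ c' z' → c' < c → T r c' ≡ just z' → ¬ (y <[ A ] z'))

TopmostGreaterInCol : ∀ {k l} → Shuffle k l → Tableau k l → ℕ → Letter k l → ℕ → Letter k l → Set
TopmostGreaterInCol A T c y i z =
  (T i c ≡ just z) × (y <[ A ] z) ×
  (∀ i' z' → i' < i → T i' c ≡ just z' → ¬ (y <[ A ] z'))

NoneGreaterInRow : ∀ {k l} → Shuffle k l → Tableau k l → ℕ → Letter k l → Set
NoneGreaterInRow A T r y = ∀ c z → T r c ≡ just z → ¬ (y <[ A ] z)

NoneGreaterInCol : ∀ {k l} → Shuffle k l → Tableau k l → ℕ → Letter k l → Set
NoneGreaterInCol A T c y = ∀ i z → T i c ≡ just z → ¬ (y <[ A ] z)

EndOfRow : ∀ {k l} → Tableau k l → ℕ → ℕ → Set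
EndOfRow T r c = (T r c ≡ nothing) × (∀ c' → c' < c → T r c' ≢ nothing)

BottomOfCol : ∀ {k l} → Tableau k l → ℕ → ℕ → Set
BottomOfCol T c i = (T i c ≡ nothing) × (∀ i' → i' < i → T i' c ≢ nothing)

-- where an entry bumped from cell (i,j) is inserted next:
-- row i+1 if a t-letter, column j+1 if a u-letter
nextLine : ∀ {k l} → Letter k l → ℕ → ℕ → ℕ
nextLine (inj₁ _) i j = suc i
nextLine (inj₂ _) i j = suc j

-- Ins A T m y T' : inserting y into row m (if y is a t-letter) resp. column m
-- (if y is a u-letter) of T under A-RSK terminates with tableau T'.
data Ins {k l : ℕ} (A : Shuffle k l) : Tableau k l → ℕ → Letter k l → Tableau k l → Set where
  t-new  : ∀ {T r a c} → NoneGreaterInRow A T r (tL a) → EndOfRow T r c →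
           Ins A T r (tL a) (setCell T r c (tL a))
  t-bump : ∀ {T r a c z T'} → LeftmostGreaterInRow A T r (tL a) c z →
           Ins A (setCell T r c (tL a)) (nextLine z r c) z T' →
           Ins A T r (tL a) T'
  u-new  : ∀ {T c b i} → NoneGreaterInCol A T c (uL b) → BottomOfCol T c i →
           Ins A T c (uL b) (setCell T i c (uL b))
  u-bump : ∀ {T c b i z T'} → TopmostGreaterInCol A T c (uL b) i z →
           Ins A (setCell T i c (uL b)) (nextLine z i c) z T' →
           Ins A T c (uL b) T'

-- inserting the letters of a word successively (first letter first), each
-- initially into row 1 / column 1 (index 0)
data InsWord {k l : ℕ} (A : Shuffle k l) : Tableau k l → ∀ {n} → Vec (Letter k l) n → Tableau k l → Set where
  done : ∀ {T} → InsWord A T [] T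
  step : ∀ {T T' T'' n x} {xs : Vec (Letter k l) n} →
         Ins A T 0 x T' → InsWord A T' xs T'' → InsWord A T (x ∷ xs) T''

InsertionTableau : ∀ {k l n} → Shuffle k l → Vec (Letter k l) n → Tableau k l → Set
InsertionTableau A v P = InsWord A emptyT v P

-- Call a letter small if it lies A-below both tᵢ and uⱼ.  As A and B differ only on the pair
-- (tᵢ, uⱼ), they compare a small letter with every letter alike, and the small letters form a
-- down-set in both orders.  A letter bumps only strictly greater letters, so inserting a large
-- letter never touches a small entry.  A small letter passes only smaller, hence small, entries
-- of its row (or column), so where it lands, and the letter it displaces when that one is small,
-- are determined by the small entries, which A- and B-insertion therefore keep in common.
-- That the passed entries fill a prefix of the line rests on the invariant that the tableaux
-- stay semistandard: t-letters repeat only along rows, u-letters only down columns.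

module Submission where

open import Defs
open import Data.Nat using (ℕ; zero; suc; _<_; _≤_; _≟_; _<?_; s≤s)
open import Data.Nat.Properties
  using ( ≤-refl; ≤-trans; ≤-reflexive; <⇒≤; <⇒≢; <-≤-trans; <-trans; ≤-<-trans; ≮⇒≥
        ; m≤n⇒m<n∨m≡n; <-cmp; 1+n≢n; n<1+n)
open import Data.Bool.Properties using (∧-zeroʳ)
open import Data.Fin using (Fin)
open import Data.Vec using (Vec)
open import Data.Maybe using (Maybe; just; nothing)
open import Data.Maybe.Properties using (just-injective)
open import Data.Product using (_×_; _,_; proj₁; ∃-syntax; swap)
open import Data.Sum using (_⊎_; inj₁; inj₂)
open import Data.Unit using (⊤)
open import Function using (_∘_)
open import Function.Bundles using (_⇔_; mk⇔; Equivalence)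
import Function.Properties.Equivalence as ⇔
open import Relation.Nullary using (¬_; yes; no; does; contradiction)
open import Relation.Nullary.Decidable using (dec-true; dec-false; _×-dec_)
open import Relation.Unary using (Decidable)
open import Relation.Binary.Definitions using (tri<; tri≈; tri>)
open import Relation.Binary.PropositionalEquality using (_≡_; _≢_; refl; sym; trans)

open Equivalence using (to; from)

transpose : ∀ {k l} → Tableau k l → Tableau k l
transpose T r c = T c r

record Updates {k l} (T : Tableau k l) (r c : ℕ) (x : Letter k l) (T′ : Tableau k l) : Set where
  field
    at-cell  : T′ r c ≡ just x
    off-cell : ∀ {i j} → i ≢ r ⊎ j ≢ c → T′ i j ≡ T i j
open Updates

setCell-updates : ∀ {k l} {T : Tableau k l} {r c x} → Updates T r c x (setCell T r c x)
setCell-updates {r = r} {c} .at-cell rewrite dec-true (r ≟ r) refl | dec-true (c ≟ c) refl = refl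
setCell-updates {r = r} {c} .off-cell {i} {j} (inj₁ i≢r) rewrite dec-false (i ≟ r) i≢r = refl
setCell-updates {r = r} {c} .off-cell {i} {j} (inj₂ j≢c)
  rewrite dec-false (j ≟ c) j≢c | ∧-zeroʳ (does (i ≟ r)) = refl

updates-transpose : ∀ {k l} {T T′ : Tableau k l} {r c x} →
  Updates T r c x T′ → Updates (transpose T) c r x (transpose T′)
updates-transpose up .at-cell = at-cell up
updates-transpose up .off-cell (inj₁ j≢c) = off-cell up (inj₂ j≢c)
updates-transpose up .off-cell (inj₂ i≢r) = off-cell up (inj₁ i≢r)

module _ {k l} (X : Shuffle k l) where

  infix 4 _≺_ _≼_ _≤ʳ_ _≤ᶜ_

  _≺_ _≼_ : Letter k l → Letter k l → Set
  a ≺ b = a <[ X ] b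
  a ≼ b = rank X a ≤ rank X b

  -- a may stand immediately left of (≤ʳ) resp. above (≤ᶜ) b.
  data _≤ʳ_ : Letter k l → Letter k l → Set where
    strict : ∀ {a b} → a ≺ b → a ≤ʳ b
    repeat : ∀ {t} → tL t ≤ʳ tL t

  data _≤ᶜ_ : Letter k l → Letter k l → Set where
    strict : ∀ {a b} → a ≺ b → a ≤ᶜ b
    repeat : ∀ {u} → uL u ≤ᶜ uL u

  ≤ʳ⇒≼ : ∀ {a b} → a ≤ʳ b → a ≼ b
  ≤ʳ⇒≼ (strict a≺b) = <⇒≤ a≺b
  ≤ʳ⇒≼ repeat = ≤-refl

  ≤ᶜ⇒≼ : ∀ {a b} → a ≤ᶜ b → a ≼ b
  ≤ᶜ⇒≼ (strict a≺b) = <⇒≤ a≺b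
  ≤ᶜ⇒≼ repeat = ≤-refl

  ≮⇒≤ʳ : ∀ {t a} → ¬ tL t ≺ a → a ≤ʳ tL t
  ≮⇒≤ʳ {t} {a} t⊀a with m≤n⇒m<n∨m≡n (≮⇒≥ t⊀a)
  ... | inj₁ a≺t = strict a≺t
  ... | inj₂ same with refl ← rank-inj X a (tL t) same = repeat

  ≮⇒≤ᶜ : ∀ {u a} → ¬ uL u ≺ a → a ≤ᶜ uL u
  ≮⇒≤ᶜ {u} {a} u⊀a with m≤n⇒m<n∨m≡n (≮⇒≥ u⊀a)
  ... | inj₁ a≺u = strict a≺u
  ... | inj₂ same with refl ← rank-inj X a (uL u) same = repeat

  t-≤ᶜ⇒≺ : ∀ {t b} → tL t ≤ᶜ b → tL t ≺ b
  t-≤ᶜ⇒≺ (strict t≺b) = t≺b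

  u-≤ʳ⇒≺ : ∀ {u b} → uL u ≤ʳ b → uL u ≺ b
  u-≤ʳ⇒≺ (strict u≺b) = u≺b

  LinesOrdered : (Letter k l → Letter k l → Set) → Tableau k l → Set
  LinesOrdered _⊑_ T = ∀ r c {b} → T r (suc c) ≡ just b → ∃[ a ] (T r c ≡ just a × a ⊑ b)

  Semistandard : Tableau k l → Set
  Semistandard T = LinesOrdered _≤ʳ_ T × LinesOrdered _≤ᶜ_ (transpose T)

  empty-semistandard : Semistandard emptyT
  empty-semistandard = (λ _ _ ()) , (λ _ _ ())

  PrefixAtMost : Tableau k l → ℕ → Letter k l → ℕ → Set
  PrefixAtMost T r y c = ∀ {c′} → c′ < c → ∃[ z ] (T r c′ ≡ just z × ¬ y ≺ z)

  Yields : Tableau k l → ℕ → Letter k l → ℕ → Set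
  Yields T r y c = T r c ≡ nothing ⊎ ∃[ z ] (T r c ≡ just z × y ≺ z)

  LandsAt : Tableau k l → ℕ → Letter k l → ℕ → Set
  LandsAt T r y c = PrefixAtMost T r y c × Yields T r y c

  lands-new : ∀ T r {y c} → NoneGreaterInRow X T r y → EndOfRow T r c → LandsAt T r y c
  lands-new T r {y} {c} none (vacant , filled) = prefix , inj₁ vacant
    where
    prefix : PrefixAtMost T r y c
    prefix {c′} c′<c with T r c′ | filled c′ c′<c | none c′
    ... | just z | _ | not-greater = z , refl , not-greater z refl
    ... | nothing | occupied | _ = contradiction refl occupied

  -- Wherever y could land in line m, the cell at that position of line m - 1 holds a smaller letter.
  FitsUnder : Tableau k l → ℕ → Letter k l → Set
  FitsUnder T zero y = ⊤
  FitsUnder T (suc r) y = ∀ c → PrefixAtMost T (suc r) y c → ∃[ w ] (T r c ≡ just w × w ≺ y)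

  fits-above : ∀ {T r y c} → FitsUnder T r y → PrefixAtMost T r y c →
    ∀ {r₀} → suc r₀ ≡ r → ∃[ w ] (T r₀ c ≡ just w × w ≺ y)
  fits-above fits prefix refl = fits _ prefix

  Insertable : Tableau k l → ℕ → Letter k l → Set
  Insertable T m (inj₁ a) = FitsUnder T m (inj₁ a)
  Insertable T m (inj₂ b) = FitsUnder (transpose T) m (inj₂ b)

  Ready : Tableau k l → ℕ → Letter k l → Set
  Ready T m y = Semistandard T × Insertable T m y

  ready-start : ∀ {T} y → Semistandard T → Ready T 0 y
  ready-start (inj₁ _) sst = sst , _
  ready-start (inj₂ _) sst = sst , _

  module _ {_⊑_ : Letter k l → Letter k l → Set} (⊑⇒≼ : ∀ {a b} → a ⊑ b → a ≼ b) where

    line-prefix : ∀ {T r c b c′} → LinesOrdered _⊑_ T → T r c ≡ just b → c′ ≤ c →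
      ∃[ a ] (T r c′ ≡ just a × a ≼ b)
    line-prefix ord eb c′≤c with m≤n⇒m<n∨m≡n c′≤c
    line-prefix ord eb c′≤c | inj₂ refl = _ , eb , ≤-refl
    line-prefix {r = r} {suc c} ord eb c′≤c | inj₁ (s≤s c′≤c₀)
      with a , ea , a⊑b ← ord r c eb
      with a′ , ea′ , a′≼a ← line-prefix ord ea c′≤c₀
      = a′ , ea′ , ≤-trans a′≼a (⊑⇒≼ a⊑b)

    yields-successor : ∀ {T r y c b} → LinesOrdered _⊑_ T → Yields T r y c →
      T r (suc c) ≡ just b → y ≺ b
    yields-successor {r = r} {c = c} ord yields eb with ord r c eb | yields
    ... | _ , ea , _ | inj₁ vacant = contradiction (trans (sym ea) vacant) λ ()
    ... | a , ea , a⊑b | inj₂ (z , ez , y≺z) with refl ← trans (sym ez) ea =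
      <-≤-trans y≺z (⊑⇒≼ a⊑b)

    lands-bump : ∀ {T r y c z} → LinesOrdered _⊑_ T → LeftmostGreaterInRow X T r y c z →
      LandsAt T r y c
    lands-bump {T} {r} {y} {c} {z} ord (ez , y≺z , leftmost) = prefix , inj₂ (z , ez , y≺z)
      where
      prefix : PrefixAtMost T r y c
      prefix {c′} c′<c with a , ea , _ ← line-prefix ord ez (<⇒≤ c′<c) =
        a , ea , leftmost c′ a c′<c ea

    ordered-at-unchanged : ∀ {T T′ : Tableau k l} {b} → LinesOrdered _⊑_ T → ∀ r c →
      T′ r (suc c) ≡ T r (suc c) → T′ r c ≡ T r c →
      T′ r (suc c) ≡ just b → ∃[ a ] (T′ r c ≡ just a × a ⊑ b)
    ordered-at-unchanged ord r c e₁ e₀ eb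
      with a , ea , a⊑b ← ord r c (trans (sym e₁) eb) = a , trans e₀ ea , a⊑b

    update-ordered : ∀ {T T′ r c x} → Updates T r c x T′ → LinesOrdered _⊑_ T →
      (∀ {c₁} → suc c₁ ≡ c → ∃[ a ] (T r c₁ ≡ just a × a ⊑ x)) →
      (∀ {b} → T r (suc c) ≡ just b → x ⊑ b) →
      LinesOrdered _⊑_ T′
    update-ordered {T′ = T′} {r} {c} up ord left right r′ c′ eb with r′ ≟ r
    ... | no r′≢r =
      ordered-at-unchanged {T′ = T′} ord r′ c′ (off-cell up (inj₁ r′≢r)) (off-cell up (inj₁ r′≢r)) eb
    ... | yes refl with suc c′ ≟ c | c′ ≟ c
    ...   | yes refl | _ with a , ea , a⊑x ← left refl with refl ← trans (sym (at-cell up)) eb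
      = a , trans (off-cell up (inj₂ (<⇒≢ (n<1+n c′)))) ea , a⊑x
    ...   | no _ | yes refl = _ , at-cell up , right (trans (sym (off-cell up (inj₂ 1+n≢n))) eb)
    ...   | no c′+1≢c | no c′≢c =
      ordered-at-unchanged {T′ = T′} ord r′ c′ (off-cell up (inj₂ c′+1≢c)) (off-cell up (inj₂ c′≢c)) eb

  -- Insertion along the lines of T: rows for t-letters, and for u-letters the
  -- rows of transpose T; _⊑_ orders entries along a line and _⊑′_ across lines.
  module Orientation {_⊑_ _⊑′_ : Letter k l → Letter k l → Set}
    (⊑⇒≼ : ∀ {a b} → a ⊑ b → a ≼ b) (⊑′⇒≼ : ∀ {a b} → a ⊑′ b → a ≼ b)
    (≺⇒⊑ : ∀ {a b} → a ≺ b → a ⊑ b) (≺⇒⊑′ : ∀ {a b} → a ≺ b → a ⊑′ b) where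

    place-ordered : ∀ {T T′ r c y} → LinesOrdered _⊑_ T → LinesOrdered _⊑′_ (transpose T) →
      LandsAt T r y c → (∀ {a} → ¬ y ≺ a → a ⊑ y) → FitsUnder T r y → Updates T r c y T′ →
      LinesOrdered _⊑_ T′ × LinesOrdered _⊑′_ (transpose T′)
    place-ordered {T} {r = r} {c} {y} ord ordᵀ (prefix , yields) ≮⇒⊑ fits up =
        update-ordered ⊑⇒≼ up ord left (≺⇒⊑ ∘ yields-successor ⊑⇒≼ ord yields)
      , update-ordered ⊑′⇒≼ (updates-transpose up) ordᵀ above
          (≺⇒⊑′ ∘ yields-successor ⊑′⇒≼ ordᵀ yields)
      where
      left : ∀ {c₁} → suc c₁ ≡ c → ∃[ a ] (T r c₁ ≡ just a × a ⊑ y)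
      left eq with a , ea , y⊀a ← prefix (≤-reflexive eq) = a , ea , ≮⇒⊑ y⊀a
      above : ∀ {r₁} → suc r₁ ≡ r → ∃[ a ] (T r₁ c ≡ just a × a ⊑′ y)
      above eq with w , ew , w≺y ← fits-above fits prefix eq = w , ew , ≺⇒⊑′ w≺y

    bumped-fits-along : ∀ {T T₁ r c y z} → LinesOrdered _⊑′_ (transpose T) →
      PrefixAtMost T r y c → T r c ≡ just z → y ≺ z → (∀ {b} → z ⊑′ b → z ≺ b) →
      Updates T r c y T₁ → FitsUnder T₁ (suc r) z
    bumped-fits-along {r = r} {c} ordᵀ prefix ez y≺z ⊑⇒≺ up c₂ prefix₂ with <-cmp c₂ c
    ... | tri< c₂<c _ _ with w , ew , y⊀w ← prefix c₂<c =
      w , trans (off-cell up (inj₂ (<⇒≢ c₂<c))) ew , ≤-<-trans (≮⇒≥ y⊀w) y≺z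
    ... | tri≈ _ refl _ = _ , at-cell up , y≺z
    ... | tri> _ _ c<c₂
      with b , eb , z⊀b ← prefix₂ c<c₂
      with a , ea , a⊑′b ← ordᵀ c r (trans (sym (off-cell up (inj₁ 1+n≢n))) eb)
      with refl ← trans (sym ez) ea = contradiction (⊑⇒≺ a⊑′b) z⊀b

    bumped-fits-across : ∀ {T T₁ r c y z} → LinesOrdered _⊑_ T → LinesOrdered _⊑′_ (transpose T) →
      FitsUnder T r y → PrefixAtMost T r y c → T r c ≡ just z → y ≺ z →
      (∀ {b} → z ⊑ b → z ≺ b) → Updates T r c y T₁ → FitsUnder (transpose T₁) (suc c) z
    bumped-fits-across {r = r} {c} ord ordᵀ fits prefix ez y≺z ⊑⇒≺ up i prefix₂ with <-cmp i r
    ... | tri≈ _ refl _ = _ , at-cell up , y≺z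
    ... | tri> _ _ r<i
      with b , eb , z⊀b ← prefix₂ r<i
      with a , ea , a⊑b ← ord r c (trans (sym (off-cell up (inj₂ 1+n≢n))) eb)
      with refl ← trans (sym ez) ea = contradiction (⊑⇒≺ a⊑b) z⊀b
    ... | tri< i<r@(s≤s i≤r₀) _ _
      with w′ , ew′ , w′≺y ← fits c prefix
      with w , ew , w≼w′ ← line-prefix ⊑′⇒≼ ordᵀ ew′ i≤r₀ =
      w , trans (off-cell up (inj₁ (<⇒≢ i<r))) ew , ≤-<-trans w≼w′ (<-trans w′≺y y≺z)

  module Rows = Orientation ≤ʳ⇒≼ ≤ᶜ⇒≼ strict strict
  module Cols = Orientation ≤ᶜ⇒≼ ≤ʳ⇒≼ strict strict

  t-place : ∀ {T r t c} → Ready T r (tL t) → LandsAt T r (tL t) c →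
    Semistandard (setCell T r c (tL t))
  t-place ((rows , cols) , fits) lands = Rows.place-ordered rows cols lands ≮⇒≤ʳ fits setCell-updates

  u-place : ∀ {T c u i} → Ready T c (uL u) → LandsAt (transpose T) c (uL u) i →
    Semistandard (setCell T i c (uL u))
  u-place ((rows , cols) , fits) lands =
    swap (Cols.place-ordered cols rows lands ≮⇒≤ᶜ fits (updates-transpose setCell-updates))

  t-bump-lands : ∀ {T r t c z} → Ready T r (tL t) → LeftmostGreaterInRow X T r (tL t) c z →
    LandsAt T r (tL t) c
  t-bump-lands ((rows , _) , _) = lands-bump ≤ʳ⇒≼ rows

  u-bump-lands : ∀ {T c u i z} → Ready T c (uL u) → TopmostGreaterInCol X T c (uL u) i z →
    LandsAt (transpose T) c (uL u) i
  u-bump-lands ((_ , cols) , _) = lands-bump ≤ᶜ⇒≼ cols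

  t-bump-ready : ∀ {T r t c z} → Ready T r (tL t) → LeftmostGreaterInRow X T r (tL t) c z →
    Ready (setCell T r c (tL t)) (nextLine z r c) z
  t-bump-ready {T} {r} {t} {c} {z} ready@((rows , cols) , fits) leftmost@(ez , t≺z , _) =
    t-place ready (prefix , inj₂ (z , ez , t≺z)) , continue z ez t≺z
    where
    prefix : PrefixAtMost T r (tL t) c
    prefix = proj₁ (t-bump-lands ready leftmost)
    continue : ∀ z → T r c ≡ just z → tL t ≺ z →
      Insertable (setCell T r c (tL t)) (nextLine z r c) z
    continue (inj₁ _) ez t≺z =
      Rows.bumped-fits-along cols prefix ez t≺z t-≤ᶜ⇒≺ setCell-updates
    continue (inj₂ _) ez t≺z =
      Rows.bumped-fits-across rows cols fits prefix ez t≺z u-≤ʳ⇒≺ setCell-updates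

  u-bump-ready : ∀ {T c u i z} → Ready T c (uL u) → TopmostGreaterInCol X T c (uL u) i z →
    Ready (setCell T i c (uL u)) (nextLine z i c) z
  u-bump-ready {T} {c} {u} {i} {z} ready@((rows , cols) , fits) topmost@(ez , u≺z , _) =
    u-place ready (prefix , inj₂ (z , ez , u≺z)) , continue z ez u≺z
    where
    prefix : PrefixAtMost (transpose T) c (uL u) i
    prefix = proj₁ (u-bump-lands ready topmost)
    continue : ∀ z → T i c ≡ just z → uL u ≺ z →
      Insertable (setCell T i c (uL u)) (nextLine z i c) z
    continue (inj₁ _) ez u≺z =
      Cols.bumped-fits-across cols rows fits prefix ez u≺z t-≤ᶜ⇒≺ (updates-transpose setCell-updates)
    continue (inj₂ _) ez u≺z =
      Cols.bumped-fits-along rows prefix ez u≺z u-≤ʳ⇒≺ (updates-transpose setCell-updates)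

  ins-semistandard : ∀ {T m y T′} → Ins X T m y T′ → Ready T m y → Semistandard T′
  ins-semistandard {T} {r} (t-new none end) ready = t-place ready (lands-new T r none end)
  ins-semistandard (t-bump leftmost ins) ready = ins-semistandard ins (t-bump-ready ready leftmost)
  ins-semistandard {T} {c} (u-new none end) ready =
    u-place ready (lands-new (transpose T) c none end)
  ins-semistandard (u-bump topmost ins) ready = ins-semistandard ins (u-bump-ready ready topmost)

DownSet : ∀ {k l} → Shuffle k l → (Letter k l → Set) → Set
DownSet Z S = ∀ {a b} → rank Z a ≤ rank Z b → S b → S a

module SmallEntries {k l} {S : Letter k l → Set} (S? : Decidable S) where

  SameSmall : Tableau k l → Tableau k l → Set
  SameSmall T T′ = ∀ r c {x} → S x → T r c ≡ just x ⇔ T′ r c ≡ just x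

  sameSmall-refl : ∀ {T} → SameSmall T T
  sameSmall-refl _ _ _ = ⇔.refl

  sameSmall-sym : ∀ {T T′} → SameSmall T T′ → SameSmall T′ T
  sameSmall-sym same r c sx = ⇔.sym (same r c sx)

  sameSmall-trans : ∀ {T T′ T″} → SameSmall T T′ → SameSmall T′ T″ → SameSmall T T″
  sameSmall-trans same same′ r c sx = ⇔.trans (same r c sx) (same′ r c sx)

  sameSmall-transpose : ∀ {T T′} → SameSmall T T′ → SameSmall (transpose T) (transpose T′)
  sameSmall-transpose same r c = same c r

  sameSmall-update : ∀ {T T′ T₁ T₁′ r c y} → Updates T r c y T₁ → Updates T′ r c y T₁′ →
    SameSmall T T′ → SameSmall T₁ T₁′
  sameSmall-update {r = r} {c} up up′ same i j sx with i ≟ r | j ≟ c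
  ... | yes refl | yes refl rewrite at-cell up | at-cell up′ = ⇔.refl
  ... | no i≢r | _
    rewrite off-cell up {i} {j} (inj₁ i≢r) | off-cell up′ {i} {j} (inj₁ i≢r) = same i j sx
  ... | yes _ | no j≢c
    rewrite off-cell up {i} {j} (inj₂ j≢c) | off-cell up′ {i} {j} (inj₂ j≢c) = same i j sx

  NoSmall : Maybe (Letter k l) → Set
  NoSmall entry = ∀ z → entry ≡ just z → ¬ S z

  vacant-noSmall : ∀ {entry} → entry ≡ nothing → NoSmall entry
  vacant-noSmall vacant _ ez = contradiction (trans (sym ez) vacant) λ ()

  large-noSmall : ∀ {entry z} → entry ≡ just z → ¬ S z → NoSmall entry
  large-noSmall ez ¬sz _ ez′ with refl ← trans (sym ez) ez′ = ¬sz

  partner-large : ∀ {T T′ r c z} → SameSmall T T′ → NoSmall (T r c) → T′ r c ≡ just z → ¬ S z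
  partner-large same none ez′ sz = none _ (from (same _ _ sz) ez′) sz

  partner-small : ∀ {T T′ r c z z′} → SameSmall T T′ → S z → T r c ≡ just z → T′ r c ≡ just z′ → z′ ≡ z
  partner-small same sz ez ez′ = just-injective (trans (sym ez′) (to (same _ _ sz) ez))

  sameSmall-update-large : ∀ {T T₁ r c y} → Updates T r c y T₁ → ¬ S y → NoSmall (T r c) →
    SameSmall T T₁
  sameSmall-update-large {r = r} {c} up ¬sy none i j sx with i ≟ r | j ≟ c
  ... | yes refl | yes refl rewrite at-cell up =
    mk⇔ (λ ex → contradiction sx (none _ ex)) λ { refl → contradiction sx ¬sy }
  ... | no i≢r | _ rewrite off-cell up {i} {j} (inj₁ i≢r) = ⇔.refl
  ... | yes _ | no j≢c rewrite off-cell up {i} {j} (inj₂ j≢c) = ⇔.refl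

  module _ {Z : Shuffle k l} (down : DownSet Z S) where

    bumped-large : ∀ {y z} → ¬ S y → y <[ Z ] z → ¬ S z
    bumped-large ¬sy y<z = ¬sy ∘ down (<⇒≤ y<z)

    ins-large-sameSmall : ∀ {T m y T′} → ¬ S y → Ins Z T m y T′ → SameSmall T T′
    ins-large-sameSmall ¬sy (t-new _ (vacant , _)) =
      sameSmall-update-large setCell-updates ¬sy (vacant-noSmall vacant)
    ins-large-sameSmall ¬sy (t-bump (ez , y<z , _) ins) =
      sameSmall-trans (sameSmall-update-large setCell-updates ¬sy (large-noSmall ez ¬sz))
                      (ins-large-sameSmall ¬sz ins)
      where ¬sz = bumped-large ¬sy y<z
    ins-large-sameSmall ¬sy (u-new _ (vacant , _)) =
      sameSmall-update-large setCell-updates ¬sy (vacant-noSmall vacant)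
    ins-large-sameSmall ¬sy (u-bump (ez , y<z , _) ins) =
      sameSmall-trans (sameSmall-update-large setCell-updates ¬sy (large-noSmall ez ¬sz))
                      (ins-large-sameSmall ¬sz ins)
      where ¬sz = bumped-large ¬sy y<z

  lands-not-before : ∀ {X Y : Shuffle k l} {T T′ r y c₁ c₂} → DownSet Y S → S y →
    (∀ z → y <[ X ] z → y <[ Y ] z) → SameSmall T T′ →
    LandsAt X T r y c₁ → LandsAt Y T′ r y c₂ → ¬ c₁ < c₂
  lands-not-before {r = r} {c₁ = c₁} downY sy X⇒Y same (_ , yields) (prefix′ , _) c₁<c₂
    with z , ez′ , y⊀z ← prefix′ c₁<c₂
    with from (same r c₁ (downY (≮⇒≥ y⊀z) sy)) ez′ | yields
  ... | ez | inj₁ vacant = contradiction (trans (sym ez) vacant) λ ()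
  ... | ez | inj₂ (z₀ , ez₀ , y<z₀) with refl ← trans (sym ez₀) ez = y⊀z (X⇒Y z y<z₀)

  module _ {X Y : Shuffle k l} (downX : DownSet X S) (downY : DownSet Y S)
           (same-order : ∀ {s} → S s → ∀ z → s <[ X ] z ⇔ s <[ Y ] z) where

    landing-unique : ∀ {T T′ r y c₁ c₂} → S y → SameSmall T T′ →
      LandsAt X T r y c₁ → LandsAt Y T′ r y c₂ → c₁ ≡ c₂
    landing-unique {c₁ = c₁} {c₂} sy same landsX landsY with <-cmp c₁ c₂
    ... | tri< c₁<c₂ _ _ =
      contradiction c₁<c₂ (lands-not-before {X} {Y} downY sy (to ∘ same-order sy) same landsX landsY)
    ... | tri≈ _ c₁≡c₂ _ = c₁≡c₂
    ... | tri> _ _ c₂<c₁ =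
      contradiction c₂<c₁
        (lands-not-before {Y} {X} downX sy (from ∘ same-order sy) (sameSmall-sym same) landsY landsX)

    place-sameSmall : ∀ {TA TB TA′ TB′ r c y} → SameSmall TA TB →
      SameSmall (setCell TA r c y) TA′ → SameSmall (setCell TB r c y) TB′ → SameSmall TA′ TB′
    place-sameSmall same placedA placedB =
      sameSmall-trans (sameSmall-sym placedA)
        (sameSmall-trans (sameSmall-update setCell-updates setCell-updates same) placedB)

    ins-small-sameSmall : ∀ {TA TB m y TA′ TB′} → S y → SameSmall TA TB →
      Ready X TA m y → Ready Y TB m y → Ins X TA m y TA′ → Ins Y TB m y TB′ → SameSmall TA′ TB′
    ins-small-sameSmall {TA} {TB} sy same _ _ (t-new {r = r} noneA endA) (t-new noneB endB)
      with refl ← landing-unique sy same (lands-new X TA r noneA endA) (lands-new Y TB r noneB endB)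
      = place-sameSmall same sameSmall-refl sameSmall-refl
    ins-small-sameSmall {TA} sy same _ readyB (t-new {r = r} noneA endA) (t-bump leftmostB insB)
      with refl ← landing-unique sy same (lands-new X TA r noneA endA) (t-bump-lands Y readyB leftmostB)
      = place-sameSmall same sameSmall-refl (ins-large-sameSmall downY large insB)
      where large = partner-large same (vacant-noSmall (proj₁ endA)) (proj₁ leftmostB)
    ins-small-sameSmall {TB = TB} sy same readyA _ (t-bump {r = r} leftmostA insA) (t-new noneB endB)
      with refl ← landing-unique sy same (t-bump-lands X readyA leftmostA) (lands-new Y TB r noneB endB)
      = place-sameSmall same (ins-large-sameSmall downX large insA) sameSmall-refl
      where large = partner-large (sameSmall-sym same) (vacant-noSmall (proj₁ endB)) (proj₁ leftmostA)
    ins-small-sameSmall sy same readyA readyB (t-bump {z = zA} leftmostA insA) (t-bump leftmostB insB)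
      with refl ← landing-unique sy same
                    (t-bump-lands X readyA leftmostA) (t-bump-lands Y readyB leftmostB)
      with S? zA
    ... | yes szA with refl ← partner-small same szA (proj₁ leftmostA) (proj₁ leftmostB)
      = ins-small-sameSmall szA (sameSmall-update setCell-updates setCell-updates same)
          (t-bump-ready X readyA leftmostA) (t-bump-ready Y readyB leftmostB) insA insB
    ... | no ¬szA =
      place-sameSmall same (ins-large-sameSmall downX ¬szA insA) (ins-large-sameSmall downY large insB)
      where large = partner-large same (large-noSmall (proj₁ leftmostA) ¬szA) (proj₁ leftmostB)
    ins-small-sameSmall {TA} {TB} sy same _ _ (u-new {c = c} noneA endA) (u-new noneB endB)
      with refl ← landing-unique sy (sameSmall-transpose same)
                    (lands-new X (transpose TA) c noneA endA) (lands-new Y (transpose TB) c noneB endB)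
      = place-sameSmall same sameSmall-refl sameSmall-refl
    ins-small-sameSmall {TA} sy same _ readyB (u-new {c = c} noneA endA) (u-bump topmostB insB)
      with refl ← landing-unique sy (sameSmall-transpose same)
                    (lands-new X (transpose TA) c noneA endA) (u-bump-lands Y readyB topmostB)
      = place-sameSmall same sameSmall-refl (ins-large-sameSmall downY large insB)
      where large = partner-large same (vacant-noSmall (proj₁ endA)) (proj₁ topmostB)
    ins-small-sameSmall {TB = TB} sy same readyA _ (u-bump {c = c} topmostA insA) (u-new noneB endB)
      with refl ← landing-unique sy (sameSmall-transpose same)
                    (u-bump-lands X readyA topmostA) (lands-new Y (transpose TB) c noneB endB)
      = place-sameSmall same (ins-large-sameSmall downX large insA) sameSmall-refl
      where large = partner-large (sameSmall-sym same) (vacant-noSmall (proj₁ endB)) (proj₁ topmostA)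
    ins-small-sameSmall sy same readyA readyB (u-bump {z = zA} topmostA insA) (u-bump topmostB insB)
      with refl ← landing-unique sy (sameSmall-transpose same)
                    (u-bump-lands X readyA topmostA) (u-bump-lands Y readyB topmostB)
      with S? zA
    ... | yes szA with refl ← partner-small same szA (proj₁ topmostA) (proj₁ topmostB)
      = ins-small-sameSmall szA (sameSmall-update setCell-updates setCell-updates same)
          (u-bump-ready X readyA topmostA) (u-bump-ready Y readyB topmostB) insA insB
    ... | no ¬szA =
      place-sameSmall same (ins-large-sameSmall downX ¬szA insA) (ins-large-sameSmall downY large insB)
      where large = partner-large same (large-noSmall (proj₁ topmostA) ¬szA) (proj₁ topmostB)

    ins-sameSmall : ∀ {TA TB y TA′ TB′} → SameSmall TA TB → Semistandard X TA → Semistandard Y TB →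
      Ins X TA 0 y TA′ → Ins Y TB 0 y TB′ → SameSmall TA′ TB′
    ins-sameSmall {y = y} same sstA sstB insA insB with S? y
    ... | yes sy = ins-small-sameSmall sy same (ready-start X y sstA) (ready-start Y y sstB) insA insB
    ... | no ¬sy = sameSmall-trans (sameSmall-sym (ins-large-sameSmall downX ¬sy insA))
                     (sameSmall-trans same (ins-large-sameSmall downY ¬sy insB))

    insWord-sameSmall : ∀ {TA TB n} {v : Vec (Letter k l) n} {PA PB} → SameSmall TA TB →
      Semistandard X TA → Semistandard Y TB → InsWord X TA v PA → InsWord Y TB v PB → SameSmall PA PB
    insWord-sameSmall same _ _ done done = same
    insWord-sameSmall same sstA sstB (step {x = x} insA wordA) (step insB wordB) =
      insWord-sameSmall (ins-sameSmall same sstA sstB insA insB)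
        (ins-semistandard X insA (ready-start X x sstA)) (ins-semistandard Y insB (ready-start Y x sstB))
        wordA wordB

    insertionTableau-sameSmall : ∀ {n} {v : Vec (Letter k l) n} {PA PB} →
      InsertionTableau X v PA → InsertionTableau Y v PB → SameSmall PA PB
    insertionTableau-sameSmall =
      insWord-sameSmall sameSmall-refl (empty-semistandard X) (empty-semistandard Y)

BelowBoth : ∀ {k l} → Shuffle k l → Fin k → Fin l → Letter k l → Set
BelowBoth A i j x = x <[ A ] tL i × x <[ A ] uL j

belowBoth? : ∀ {k l} (A : Shuffle k l) i j → Decidable (BelowBoth A i j)
belowBoth? A i j x = rank A x <? rank A (tL i) ×-dec rank A x <? rank A (uL j)

belowBoth-downSet : ∀ {k l} (A : Shuffle k l) i j → DownSet A (BelowBoth A i j)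
belowBoth-downSet A i j a≼b (b<t , b<u) = ≤-<-trans a≼b b<t , ≤-<-trans a≼b b<u

downSet-resp-⇔ : ∀ {k l} {Z : Shuffle k l} {P Q : Letter k l → Set} →
  (∀ {x} → P x ⇔ Q x) → DownSet Z Q → DownSet Z P
downSet-resp-⇔ P⇔Q down a≼b pb = from P⇔Q (down a≼b (to P⇔Q pb))

belowBoth-distinct : ∀ {k l} (A : Shuffle k l) {i j x} → BelowBoth A i j x → x ≢ tL i × x ≢ uL j
belowBoth-distinct A (x<t , x<u) = (λ { refl → <⇒≢ x<t refl }) , (λ { refl → <⇒≢ x<u refl })

adjacent-same-order : ∀ {k l} (A B : Shuffle k l) i j → Adjacent A B i j →
  ∀ {x} → x ≢ tL i × x ≢ uL j → ∀ z → x <[ A ] z ⇔ x <[ B ] z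
adjacent-same-order A B i j (_ , _ , others) (x≢t , x≢u) z = others _ z (x≢t ∘ proj₁) (x≢u ∘ proj₁)

belowBoth-adjacent : ∀ {k l} (A B : Shuffle k l) i j → Adjacent A B i j →
  ∀ {x} → BelowBoth A i j x ⇔ BelowBoth B i j x
belowBoth-adjacent A B i j adj {x} = mk⇔
  (λ below@(x<t , x<u) → to (same A below (tL i)) x<t , to (same A below (uL j)) x<u)
  (λ below@(x<t , x<u) → from (same B below (tL i)) x<t , from (same B below (uL j)) x<u)
  where
  same : ∀ C → BelowBoth C i j x → ∀ z → x <[ A ] z ⇔ x <[ B ] z
  same C = adjacent-same-order A B i j adj ∘ belowBoth-distinct C

corollary2p7 : ∀ {k l n} (A B : Shuffle k l) (i : Fin k) (j : Fin l) →
    Adjacent A B i j →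
    (v : Vec (Letter k l) n) (PA PB : Tableau k l) →
    InsertionTableau A v PA → InsertionTableau B v PB →
    ∀ (r c : ℕ) (x : Letter k l) →
      ((PA r c ≡ just x × x <[ A ] tL i × x <[ A ] uL j) ⇔
       (PB r c ≡ just x × x <[ B ] tL i × x <[ B ] uL j))
corollary2p7 A B i j adj v PA PB insA insB r c x =
  mk⇔ (λ (ex , below) → to (same r c below) ex , to belowBoth below)
      (λ (ex , below) → from (same r c (from belowBoth below)) ex , from belowBoth below)
  where
  open SmallEntries (belowBoth? A i j)
  belowBoth : ∀ {x} → BelowBoth A i j x ⇔ BelowBoth B i j x
  belowBoth = belowBoth-adjacent A B i j adj
  same : SameSmall PA PB
  same = insertionTableau-sameSmall
    (belowBoth-downSet A i j)
    (downSet-resp-⇔ {Z = B} {Q = BelowBoth B i j} belowBoth (belowBoth-downSet B i j))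
    (λ {s} → adjacent-same-order A B i j adj ∘ belowBoth-distinct A {x = s}) insA insB
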